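{- Let $p\ge 1$, $s,t\ge 0$, $a_1,\dots,a_p,b_1,\dots,b_p\ge 1$ be integers, and let $A(n)$ be a well-defined solution (with positive initial values) of the recursion $$A(n)=A\Big(n-s-\sum_{j=1}^p A(n-a_j)\Big)+A\Big(n-t-\sum_{j=1}^p A(n-b_j)\Big).$$ Suppose $A$ is a slow $(\alpha,\beta)$-Conolly sequence, where $\alpha,\beta$ are integers. Then $\alpha+2\beta=2p$, $\alpha+\beta>0$, and $\beta\ge 0$.
   Context: For a positive integer $m$, the ruler function $r_m$ is $1$ plus the exponent of $2$ in the prime factorization of $m$ (so $r_m=1,2,1,3,1,2,1,4,\dots$). A nondecreasing sequence of positive integers is $(\alpha,\beta)$-Conolly if for every positive integer $m$ the number of times $m$ occurs in the sequence is $\alpha+\beta r_m$. A sequence is slow (slowly growing) if its successive differences are all $0$ or $1$ and it tends to infinity. -}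

module Defs where

open import Data.Nat using (ℕ; zero; suc; _+_; _∸_; _≤_; _<_; _≡ᵇ_)
open import Data.Nat.DivMod using (_/_; _%_)
open import Data.Fin using (Fin; zero; suc)
open import Data.Bool using (if_then_else_)
open import Data.Integer as ℤ using (ℤ)
open import Data.Product using (Σ; _×_; ∃)
open import Data.Sum using (_⊎_)
open import Relation.Binary.PropositionalEquality using (_≡_; _≢_)

-- Sequences are functions ℕ → ℕ, indexed from 1 (the value at 0 is ignored).

sumFin : ∀ {p} → (Fin p → ℕ) → ℕ
sumFin {zero}  f = 0
sumFin {suc p} f = f zero + sumFin (λ j → f (suc j))

ν₂-fuel : ℕ → ℕ → ℕ
ν₂-fuel zero     m = 0
ν₂-fuel (suc k)  zero = 0
ν₂-fuel (suc k)  (suc m) with (suc m) % 2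
... | zero  = suc (ν₂-fuel k (suc m / 2))
... | suc _ = 0

ν₂ : ℕ → ℕ
ν₂ m = ν₂-fuel m m

ruler : ℕ → ℕ
ruler m = suc (ν₂ m)

countUpTo : (ℕ → ℕ) → ℕ → ℕ → ℕ
countUpTo A m zero    = 0
countUpTo A m (suc N) = countUpTo A m N + (if A (suc N) ≡ᵇ m then 1 else 0)

OccursExactly : (ℕ → ℕ) → ℕ → ℕ → Set
OccursExactly A m k =
  Σ ℕ λ N → ((n : ℕ) → N < n → A n ≢ m) × (countUpTo A m N ≡ k)

PositiveSeq : (ℕ → ℕ) → Set
PositiveSeq A = (n : ℕ) → 1 ≤ n → 1 ≤ A n

Nondecreasing : (ℕ → ℕ) → Set
Nondecreasing A = (n : ℕ) → 1 ≤ n → A n ≤ A (suc n)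

TendsToInfinity : (ℕ → ℕ) → Set
TendsToInfinity A = (M : ℕ) → Σ ℕ λ N → (n : ℕ) → N ≤ n → M ≤ A n

Slow : (ℕ → ℕ) → Set
Slow A = ((n : ℕ) → 1 ≤ n → (A (suc n) ≡ A n) ⊎ (A (suc n) ≡ suc (A n)))
       × TendsToInfinity A

Conolly : ℤ → ℤ → (ℕ → ℕ) → Set
Conolly α β A = PositiveSeq A × Nondecreasing A ×
  ((m : ℕ) → 1 ≤ m → Σ ℕ λ k → OccursExactly A m k × (ℤ.+ k ≡ α ℤ.+ β ℤ.* ℤ.+ ruler m))

inner : ∀ {p} → (ℕ → ℕ) → (Fin p → ℕ) → ℕ → ℕ
inner A c n = sumFin (λ j → A (n ∸ c j))

-- A is a well-defined solution, with positive initial values A(1..c0), of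
-- A(n) = A(n - s - Σ_j A(n - a_j)) + A(n - t - Σ_j A(n - b_j)) for all n > c0:
-- every argument lies in [1, n-1] (so truncated subtraction is exact).
WellDefinedSolution : ∀ {p} → ℕ → ℕ → (Fin p → ℕ) → (Fin p → ℕ) → (ℕ → ℕ) → Set
WellDefinedSolution s t a b A =
  Σ ℕ λ c0 →
    ((i : ℕ) → 1 ≤ i → i ≤ c0 → 1 ≤ A i) ×
    ((n : ℕ) → c0 < n →
       ((j : Fin _) → a j < n) × ((j : Fin _) → b j < n) ×
       (1 ≤ s + inner A a n) × (s + inner A a n < n) ×
       (1 ≤ t + inner A b n) × (t + inner A b n < n) ×
       (A n ≡ A (n ∸ (s + inner A a n)) + A (n ∸ (t + inner A b n))))

-- Taking m odd (a slow sequence takes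
-- some odd value) gives α + β > 0; taking m = 2 ^ (α + β + 1) gives β ≥ 0.  Hence,
-- with V(M) = Σ_{m ≤ M} ν₂ m and M - k ≤ V(M) ≤ M for M < 2 ^ k, the number of
-- indices with value at most M is (α + 2β) M up to an error O(k), so that
-- (α + 2β) A(n) = n + O(log n).  Multiplying the recursion by α + 2β and inserting
-- this estimate everywhere gives (α + 2β) n = 2p n + O(log n), whence α + 2β = 2p.
module Submission where

open import Defs
open import Data.Nat
open import Data.Nat.Properties
open import Data.Nat.DivMod using (_%_; _/_; m/n<m; [m+kn]%n≡m%n; m*n%n≡0; m*n/n≡m)
open import Data.Fin using (Fin; zero; suc)
open import Data.Integer as ℤ using (ℤ)
import Data.Integer.Properties as ℤP
open import Data.Product using (Σ; ∃; ∃-syntax; _×_; _,_; proj₁; proj₂)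
open import Data.Sum using (_⊎_; inj₁; inj₂)
open import Data.Empty using (⊥-elim)
open import Data.Bool using (true; false; T; if_then_else_)
open import Relation.Nullary using (yes; no)
open import Relation.Binary.Definitions using (tri<; tri≈; tri>)
open import Relation.Binary.PropositionalEquality
open import Algebra.Properties.CommutativeSemigroup +-commutativeSemigroup
  using (interchange; x∙yz≈y∙xz; xy∙z≈xz∙y)
import Data.Nat.Tactic.RingSolver as ℕ-Ring
import Data.Integer.Tactic.RingSolver as ℤ-Ring

ν₂-fuel-stable : ∀ f g m → m ≤ f → m ≤ g → ν₂-fuel f m ≡ ν₂-fuel g m
ν₂-fuel-stable zero    zero    zero    _ _ = refl
ν₂-fuel-stable zero    (suc g) zero    _ _ = refl
ν₂-fuel-stable (suc f) zero    zero    _ _ = refl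
ν₂-fuel-stable (suc f) (suc g) zero    _ _ = refl
ν₂-fuel-stable (suc f) (suc g) (suc m) (s≤s m≤f) (s≤s m≤g) with suc m % 2
... | zero  = cong suc (ν₂-fuel-stable f g (suc m / 2) (≤-trans half≤m m≤f) (≤-trans half≤m m≤g))
  where half≤m : suc m / 2 ≤ m
        half≤m = <⇒≤pred (m/n<m (suc m) 2 (s≤s (s≤s z≤n)))
... | suc _ = refl

odd%2 : ∀ q → suc (2 * q) % 2 ≡ 1
odd%2 q = trans (cong (λ x → suc x % 2) (*-comm 2 q)) ([m+kn]%n≡m%n 1 q 2)

even%2 : ∀ q → (2 * q) % 2 ≡ 0
even%2 q = trans (cong (_% 2) (*-comm 2 q)) (m*n%n≡0 q 2)

ν₂-odd : ∀ q → ν₂ (suc (2 * q)) ≡ 0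
ν₂-odd q with suc (2 * q) % 2 in parity
... | suc _ = refl
... | zero with () ← trans (sym parity) (odd%2 q)

ν₂-double : ∀ q → ν₂ (2 * suc q) ≡ suc (ν₂ (suc q))
ν₂-double q with (2 * suc q) % 2 in parity
... | suc _ with () ← trans (sym parity) (even%2 (suc q))
... | zero = cong suc (begin
    ν₂-fuel F (2 * suc q / 2) ≡⟨ cong (ν₂-fuel F) halve-double ⟩
    ν₂-fuel F (suc q)         ≡⟨ ν₂-fuel-stable F (suc q) (suc q) (≤-trans (s≤s (m≤m+n q 0)) (m≤n+m _ q)) ≤-refl ⟩
    ν₂ (suc q)                ∎)
  where
    open ≡-Reasoning
    F = q + suc (q + 0)
    halve-double : 2 * suc q / 2 ≡ suc q
    halve-double = trans (cong (_/ 2) (*-comm 2 (suc q))) (m*n/n≡m (suc q) 2)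

ν₂-pow : ∀ j → ν₂ (2 ^ j) ≡ j
ν₂-pow zero = refl
ν₂-pow (suc j) with 2 ^ j | ν₂-pow j | m^n>0 2 j
... | suc q | ν₂[2^j]≡j | _ = trans (ν₂-double q) (cong suc ν₂[2^j]≡j)

n<2^n : ∀ n → n < 2 ^ n
n<2^n zero    = s≤s z≤n
n<2^n (suc n) = +-mono-≤ (m^n>0 2 n) (≤-trans (n<2^n n) (m≤m+n _ 0))

affine<2^ : ∀ U W → ∃[ k ] U + W * k < 2 ^ k
affine<2^ U W = j + j , (begin-strict
    U + W * (j + j)     ≡⟨ cong (U +_) (double-factor W j) ⟩
    U + (W + W) * j     ≤⟨ +-monoʳ-≤ U (*-monoˡ-≤ j (m≤n+m (W + W) U)) ⟩
    U + j * j           <⟨ +-monoˡ-< (j * j) (s≤s (m≤m+n U (W + W))) ⟩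
    suc j + j * j       ≤⟨ +-monoʳ-≤ (suc j) (*-monoʳ-≤ j (n≤1+n j)) ⟩
    suc j * suc j       ≤⟨ *-mono-≤ (n<2^n j) (n<2^n j) ⟩
    2 ^ j * 2 ^ j       ≡⟨ sym (^-distribˡ-+-* 2 j j) ⟩
    2 ^ (j + j)         ∎)
  where
    open ≤-Reasoning
    j = U + (W + W)
    double-factor : ∀ w i → w * (i + i) ≡ (w + w) * i
    double-factor = ℕ-Ring.solve-∀

sumTo : ℕ → (ℕ → ℕ) → ℕ
sumTo zero    f = 0
sumTo (suc M) f = sumTo M f + f (suc M)

sumTo-zero : ∀ M → sumTo M (λ _ → 0) ≡ 0
sumTo-zero zero    = refl
sumTo-zero (suc M) = cong (_+ 0) (sumTo-zero M)

sumTo-+ : ∀ M f g → sumTo M (λ m → f m + g m) ≡ sumTo M f + sumTo M g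
sumTo-+ zero    f g = refl
sumTo-+ (suc M) f g = trans (cong (_+ (f (suc M) + g (suc M))) (sumTo-+ M f g))
                            (interchange (sumTo M f) (sumTo M g) (f (suc M)) (g (suc M)))

sumTo-cong : ∀ M {f g} → (∀ m → f (suc m) ≡ g (suc m)) → sumTo M f ≡ sumTo M g
sumTo-cong zero    f≗g = refl
sumTo-cong (suc M) f≗g = cong₂ _+_ (sumTo-cong M f≗g) (f≗g M)

sumTo-affine : ∀ M k b f → sumTo M (λ m → k + b * f m) ≡ M * k + b * sumTo M f
sumTo-affine zero    k b f = sym (*-zeroʳ b)
sumTo-affine (suc M) k b f = trans (cong (_+ (k + b * f (suc M))) (sumTo-affine M k b f))
                                   (regroup M k b (sumTo M f) (f (suc M)))
  where
    regroup : ∀ M k b S x → M * k + b * S + (k + b * x) ≡ suc M * k + b * (S + x)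
    regroup = ℕ-Ring.solve-∀

-- V M = Σ_{m=1}^{M} ν₂ m, the exponent of 2 in M!.
V : ℕ → ℕ
V M = sumTo M ν₂

-- Halving recursions for V, from ν₂ (2q + 1) = 0 and ν₂ (2q + 2) = 1 + ν₂ (q + 1).
V-double : ∀ q → V (2 * q) ≡ V q + q
V-double zero    = refl
V-double (suc q) = begin
    V (2 * suc q)                                          ≡⟨ cong V (*-suc 2 q) ⟩
    V (2 * q) + ν₂ (suc (2 * q)) + ν₂ (suc (suc (2 * q))) ≡⟨ cong₂ (λ x y → x + y + ν₂ (suc (suc (2 * q)))) (V-double q) (ν₂-odd q) ⟩
    V q + q + 0 + ν₂ (suc (suc (2 * q)))                   ≡⟨ cong (V q + q + 0 +_) (trans (cong ν₂ (sym (*-suc 2 q))) (ν₂-double q)) ⟩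
    V q + q + 0 + suc (ν₂ (suc q))                         ≡⟨ regroup (V q) q (ν₂ (suc q)) ⟩
    V q + ν₂ (suc q) + suc q                               ∎
  where
    open ≡-Reasoning
    regroup : ∀ v q n → v + q + 0 + suc n ≡ v + n + suc q
    regroup = ℕ-Ring.solve-∀

V-odd : ∀ q → V (suc (2 * q)) ≡ V q + q
V-odd q = trans (cong₂ _+_ (V-double q) (ν₂-odd q)) (+-identityʳ _)

even-or-odd : ∀ M → ∃[ q ] (M ≡ 2 * q ⊎ M ≡ suc (2 * q))
even-or-odd zero = 0 , inj₁ refl
even-or-odd (suc M) with even-or-odd M
... | q , inj₁ M≡2q   = q , inj₂ (cong suc M≡2q)
... | q , inj₂ M≡2q+1 = suc q , inj₁ (trans (cong suc M≡2q+1) (sym (*-suc 2 q)))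

halve : ∀ M → ∃[ q ] (2 * q ≤ M × M ≤ suc (2 * q) × V M ≡ V q + q)
halve M with even-or-odd M
... | q , inj₁ refl = q , ≤-refl , n≤1+n _ , V-double q
... | q , inj₂ refl = q , n≤1+n _ , ≤-refl , V-odd q

V-bounds : ∀ k M → M < 2 ^ k → V M ≤ M × M ≤ V M + k
V-bounds zero    zero    _        = z≤n , z≤n
V-bounds zero    (suc M) (s≤s ())
V-bounds (suc k) M       M<2^k+1 with halve M
... | q , 2q≤M , M≤2q+1 , V-eq with V-bounds k q (*-cancelˡ-< 2 q (2 ^ k) (≤-<-trans 2q≤M M<2^k+1))
...   | Vq≤q , q≤Vq+k = V≤M , M≤V+k
  where
    open ≤-Reasoning
    V≤M : V M ≤ M
    V≤M = begin
      V M     ≡⟨ V-eq ⟩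
      V q + q ≤⟨ +-monoˡ-≤ q Vq≤q ⟩
      q + q   ≡⟨ cong (q +_) (sym (+-identityʳ q)) ⟩
      2 * q   ≤⟨ 2q≤M ⟩
      M       ∎
    M≤V+k : M ≤ V M + suc k
    M≤V+k = begin
      M                 ≤⟨ M≤2q+1 ⟩
      suc (2 * q)       ≡⟨ cong suc (cong (q +_) (+-identityʳ q)) ⟩
      suc (q + q)       ≤⟨ s≤s (+-monoˡ-≤ q q≤Vq+k) ⟩
      suc (V q + k + q) ≡⟨ regroup (V q) k q ⟩
      V q + q + suc k   ≡⟨ cong (_+ suc k) (sym V-eq) ⟩
      V M + suc k       ∎
      where
        regroup : ∀ v k q → suc (v + k + q) ≡ v + q + suc k
        regroup = ℕ-Ring.solve-∀

hit : ℕ → ℕ → ℕ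
hit x m = if x ≡ᵇ m then 1 else 0

hit-refl : ∀ x → hit x x ≡ 1
hit-refl zero    = refl
hit-refl (suc x) = hit-refl x

hit-≢ : ∀ {x m} → x ≢ m → hit x m ≡ 0
hit-≢ {x} {m} x≢m with x ≡ᵇ m in eq
... | true  = ⊥-elim (x≢m (≡ᵇ⇒≡ x m (subst T (sym eq) _)))
... | false = refl

hitsUpTo : ℕ → ℕ → ℕ
hitsUpTo x M = sumTo M (hit x)

hitsUpTo-above : ∀ x M → M < x → hitsUpTo x M ≡ 0
hitsUpTo-above x zero    _   = refl
hitsUpTo-above x (suc M) M<x =
  cong₂ _+_ (hitsUpTo-above x M (<-trans (n<1+n M) M<x)) (hit-≢ (λ x≡M → <-irrefl (sym x≡M) M<x))

hitsUpTo≤1 : ∀ x M → hitsUpTo x M ≤ 1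
hitsUpTo≤1 x zero = z≤n
hitsUpTo≤1 x (suc M) with x ≟ suc M
... | yes refl = ≤-reflexive (cong₂ _+_ (hitsUpTo-above x M ≤-refl) (hit-refl x))
... | no  x≢M  = ≤-trans (≤-reflexive (trans (cong (hitsUpTo x M +_) (hit-≢ x≢M)) (+-identityʳ _)))
                         (hitsUpTo≤1 x M)

hitsUpTo-within : ∀ x M → 1 ≤ x → x ≤ M → 1 ≤ hitsUpTo x M
hitsUpTo-within (suc _) zero    _ ()
hitsUpTo-within x (suc M) 1≤x x≤M with x ≟ suc M
... | yes refl = ≤-trans (≤-reflexive (sym (hit-refl x))) (m≤n+m _ (hitsUpTo x M))
... | no  x≢M  = ≤-trans (hitsUpTo-within x M 1≤x (≤-pred (≤∧≢⇒< x≤M x≢M))) (m≤m+n _ _)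

-- below A M N = Σ_{m=1}^{M} countUpTo A m N = #{n ≤ N : 1 ≤ A n ≤ M}.
below : (ℕ → ℕ) → ℕ → ℕ → ℕ
below A M N = sumTo M (λ m → countUpTo A m N)

below-suc : ∀ A M N → below A M (suc N) ≡ below A M N + hitsUpTo (A (suc N)) M
below-suc A M N = sumTo-+ M (λ m → countUpTo A m N) (hit (A (suc N)))

below≤ : ∀ A M N → below A M N ≤ N
below≤ A M zero    = ≤-reflexive (sumTo-zero M)
below≤ A M (suc N) = begin
  below A M (suc N)                          ≡⟨ below-suc A M N ⟩
  below A M N + hitsUpTo (A (suc N)) M       ≤⟨ +-mono-≤ (below≤ A M N) (hitsUpTo≤1 (A (suc N)) M) ⟩
  N + 1                                      ≡⟨ +-comm N 1 ⟩
  suc N                                      ∎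
  where open ≤-Reasoning

below-mono : ∀ A M {N} N′ → N ≤ N′ → below A M N ≤ below A M N′
below-mono A M N′ N≤N′ with m≤n⇒m<n∨m≡n N≤N′
... | inj₂ refl = ≤-refl
below-mono A M {N} (suc N′) _ | inj₁ (s≤s N≤N′) = begin
  below A M N                                 ≤⟨ below-mono A M N′ N≤N′ ⟩
  below A M N′                                ≤⟨ m≤m+n _ _ ⟩
  below A M N′ + hitsUpTo (A (suc N′)) M      ≡⟨ sym (below-suc A M N′) ⟩
  below A M (suc N′)                          ∎
  where open ≤-Reasoning

below-full : ∀ A M n → (∀ i → 1 ≤ i → i ≤ n → 1 ≤ A i × A i ≤ M) → n ≤ below A M n
below-full A M zero    inRange = z≤n
below-full A M (suc n) inRange = begin
  suc n                                   ≡⟨ +-comm 1 n ⟩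
  n + 1                                   ≤⟨ +-mono-≤ (below-full A M n (λ i 1≤i i≤n → inRange i 1≤i (m≤n⇒m≤1+n i≤n)))
                                                      (hitsUpTo-within _ M 1≤A A≤M) ⟩
  below A M n + hitsUpTo (A (suc n)) M    ≡⟨ sym (below-suc A M n) ⟩
  below A M (suc n)                       ∎
  where
    open ≤-Reasoning
    1≤A = proj₁ (inRange (suc n) (s≤s z≤n) ≤-refl)
    A≤M = proj₂ (inRange (suc n) (s≤s z≤n) ≤-refl)

below-bounded : ∀ A M n → (∀ i → suc n ≤ i → M < A i) → ∀ N → below A M N ≤ n
below-bounded A M n large zero    = ≤-trans (≤-reflexive (sumTo-zero M)) z≤n
below-bounded A M n large (suc N) with suc N ≤? n
... | yes N<n = ≤-trans (below≤ A M (suc N)) N<n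
... | no  N≮n = begin
  below A M (suc N)                       ≡⟨ below-suc A M N ⟩
  below A M N + hitsUpTo (A (suc N)) M    ≡⟨ cong (below A M N +_) (hitsUpTo-above _ M (large (suc N) (≰⇒> N≮n))) ⟩
  below A M N + 0                         ≡⟨ +-identityʳ _ ⟩
  below A M N                             ≤⟨ below-bounded A M n large N ⟩
  n                                       ∎
  where open ≤-Reasoning

countUpTo-frozen : ∀ A m {N₀} → (∀ n → N₀ < n → A n ≢ m) → ∀ N → N₀ ≤ N → countUpTo A m N ≡ countUpTo A m N₀
countUpTo-frozen A m absent N N₀≤N with m≤n⇒m<n∨m≡n N₀≤N
... | inj₂ refl = refl
countUpTo-frozen A m {N₀} absent (suc N) _ | inj₁ (s≤s N₀≤N) = begin
  countUpTo A m (suc N) ≡⟨ cong (countUpTo A m N +_) (hit-≢ (absent (suc N) (s≤s N₀≤N))) ⟩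
  countUpTo A m N + 0   ≡⟨ +-identityʳ _ ⟩
  countUpTo A m N       ≡⟨ countUpTo-frozen A m absent N N₀≤N ⟩
  countUpTo A m N₀      ∎
  where open ≡-Reasoning

countUpTo-pos : ∀ A m N i → 1 ≤ i → i ≤ N → A i ≡ m → 1 ≤ countUpTo A m N
countUpTo-pos A m zero    (suc _) _ () _
countUpTo-pos A m (suc N) i 1≤i i≤N Ai≡m with i ≟ suc N
... | yes refl = ≤-trans (≤-reflexive (sym (subst (λ v → hit (A i) v ≡ 1) Ai≡m (hit-refl (A i))))) (m≤n+m _ _)
... | no  i≢N  = ≤-trans (countUpTo-pos A m N i 1≤i (≤-pred (≤∧≢⇒< i≤N i≢N)) Ai≡m) (m≤m+n _ _)

nondecreasing-mono : ∀ {A} → Nondecreasing A → ∀ {i} j → 1 ≤ i → i ≤ j → A i ≤ A j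
nondecreasing-mono nd {i} j 1≤i i≤j with m≤n⇒m<n∨m≡n i≤j
... | inj₂ refl = ≤-refl
... | inj₁ (s≤s i≤j-1) = ≤-trans (nondecreasing-mono nd _ 1≤i i≤j-1) (nd _ (≤-trans 1≤i i≤j-1))

slow-growth : ∀ {A} → Slow A → ∀ m → A (suc m) ≤ A 1 + m
slow-growth {A} slow zero    = m≤m+n _ 0
slow-growth {A} slow (suc m) with proj₁ slow (suc m) (s≤s z≤n)
... | inj₁ same = ≤-trans (≤-reflexive same) (≤-trans (slow-growth slow m) (+-monoʳ-≤ (A 1) (n≤1+n m)))
... | inj₂ up   = ≤-trans (≤-reflexive up) (≤-trans (s≤s (slow-growth slow m)) (≤-reflexive (sym (+-suc (A 1) m))))

slow-step : ∀ {A} → Slow A → ∃[ i ] (1 ≤ i × A (suc i) ≡ suc (A i))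
slow-step {A} slow = climb N (large (suc N) (n≤1+n N))
  where
    N = proj₁ (proj₂ slow (suc (A 1)))
    large = proj₂ (proj₂ slow (suc (A 1)))
    climb : ∀ N → A 1 < A (suc N) → ∃[ i ] (1 ≤ i × A (suc i) ≡ suc (A i))
    climb zero    A1<A1 = ⊥-elim (<-irrefl refl A1<A1)
    climb (suc N) A1<A with A 1 <? A (suc N)
    ... | yes A1<A′ = climb N A1<A′
    ... | no  A1≮A′ with proj₁ slow (suc N) (s≤s z≤n)
    ...   | inj₁ same = ⊥-elim (A1≮A′ (subst (A 1 <_) same A1<A))
    ...   | inj₂ up   = suc N , s≤s z≤n , up

slow-odd-value : ∀ {A} → Slow A → ∃[ i ] ∃[ q ] (1 ≤ i × A i ≡ suc (2 * q))
slow-odd-value {A} slow with slow-step slow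
... | i , 1≤i , up with even-or-odd (A i)
...   | q , inj₁ even = suc i , q , s≤s z≤n , trans up (cong suc even)
...   | q , inj₂ odd  = i , q , 1≤i , odd

nonneg-slope : ∀ {K k j} (γ : ℤ) → ℤ.+ K ≡ ℤ.+ k ℤ.+ γ ℤ.* ℤ.+ j → k < j → ∃[ b ] γ ≡ ℤ.+ b
nonneg-slope (ℤ.+ b)      _ _   = b , refl
nonneg-slope {K} {k} {j} ℤ.-[1+ b ] K≡ k<j = ⊥-elim (<⇒≱ k<j j≤k)
  where
    y = ℤ.+ suc b ℤ.* ℤ.+ j
    cancel : ∀ (x y : ℤ) → (x ℤ.+ ℤ.- y) ℤ.+ y ≡ x
    cancel = ℤ-Ring.solve-∀
    K+bj≡k : ℤ.+ (K + suc b * j) ≡ ℤ.+ k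
    K+bj≡k = begin
      ℤ.+ (K + suc b * j)                        ≡⟨ ℤP.pos-+ K (suc b * j) ⟩
      ℤ.+ K ℤ.+ ℤ.+ (suc b * j)                  ≡⟨ cong₂ ℤ._+_ K≡ (ℤP.pos-* (suc b) j) ⟩
      ℤ.+ k ℤ.+ ℤ.-[1+ b ] ℤ.* ℤ.+ j ℤ.+ y       ≡⟨ cong (λ z → ℤ.+ k ℤ.+ z ℤ.+ y) (sym (ℤP.neg-distribˡ-* (ℤ.+ suc b) (ℤ.+ j))) ⟩
      ℤ.+ k ℤ.+ ℤ.- y ℤ.+ y                      ≡⟨ cancel (ℤ.+ k) y ⟩
      ℤ.+ k                                      ∎
      where open ≡-Reasoning
    j≤k : j ≤ k
    j≤k = begin
      j             ≤⟨ m≤m*n j (suc b) ⟩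
      j * suc b     ≡⟨ *-comm j (suc b) ⟩
      suc b * j     ≤⟨ m≤n+m _ K ⟩
      K + suc b * j ≡⟨ ℤP.+-injective K+bj≡k ⟩
      k             ∎
      where open ≤-Reasoning

Approximates : ℕ → ℕ → (ℕ → ℕ) → ℕ → Set
Approximates c E A n = ∀ m → 1 ≤ m → m ≤ n → m ≤ c * A m × c * A m ≤ m + E

look-back : ∀ {c E A n} → Approximates c E A n → ∀ D → D < n →
  n ≤ c * A (n ∸ D) + D × c * A (n ∸ D) + D ≤ n + E
look-back {c} {E} {A} {n} approx D D<n = lower , upper
  where
    bounds = approx (n ∸ D) (m<n⇒0<n∸m D<n) (m∸n≤m n D)
    n-D+D≡n : n ∸ D + D ≡ n
    n-D+D≡n = m∸n+n≡m (<⇒≤ D<n)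
    lower : n ≤ c * A (n ∸ D) + D
    lower = subst (_≤ c * A (n ∸ D) + D) n-D+D≡n (+-monoˡ-≤ D (proj₁ bounds))
    upper : c * A (n ∸ D) + D ≤ n + E
    upper = begin
      c * A (n ∸ D) + D   ≤⟨ +-monoˡ-≤ D (proj₂ bounds) ⟩
      n ∸ D + E + D       ≡⟨ xy∙z≈xz∙y (n ∸ D) E D ⟩
      n ∸ D + D + E       ≡⟨ cong (_+ E) n-D+D≡n ⟩
      n + E               ∎
      where open ≤-Reasoning

recurrence-distances : ∀ {c E A n} → Approximates c E A n → ∀ X Y → X < n → Y < n →
  A n ≡ A (n ∸ X) + A (n ∸ Y) → n ≤ X + Y + E × X + Y ≤ n + (E + E)
recurrence-distances {c} {E} {A} {n} approx X Y X<n Y<n A-rec =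
  +-cancelˡ-≤ n _ _ lower , +-cancelˡ-≤ n _ _ upper
  where
    u = c * A (n ∸ X)
    v = c * A (n ∸ Y)
    split : c * A n ≡ u + v
    split = trans (cong (c *_) A-rec) (*-distribˡ-+ c _ _)
    bX = look-back {c} {E} {A} approx X X<n
    bY = look-back {c} {E} {A} approx Y Y<n
    bn = approx n (≤-trans (s≤s z≤n) X<n) ≤-refl
    lower : n + n ≤ n + (X + Y + E)
    lower = begin
      n + n               ≤⟨ +-mono-≤ (proj₁ bX) (proj₁ bY) ⟩
      (u + X) + (v + Y)   ≡⟨ interchange u X v Y ⟩
      (u + v) + (X + Y)   ≤⟨ +-monoˡ-≤ (X + Y) (subst (_≤ n + E) split (proj₂ bn)) ⟩
      (n + E) + (X + Y)   ≡⟨ regroup n E (X + Y) ⟩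
      n + (X + Y + E)     ∎
      where
        open ≤-Reasoning
        regroup : ∀ n e z → (n + e) + z ≡ n + (z + e)
        regroup = ℕ-Ring.solve-∀
    upper : n + (X + Y) ≤ n + (n + (E + E))
    upper = begin
      n + (X + Y)         ≤⟨ +-monoˡ-≤ (X + Y) (subst (n ≤_) split (proj₁ bn)) ⟩
      (u + v) + (X + Y)   ≡⟨ interchange u v X Y ⟩
      (u + X) + (v + Y)   ≤⟨ +-mono-≤ (proj₂ bX) (proj₂ bY) ⟩
      (n + E) + (n + E)   ≡⟨ regroup n E ⟩
      n + (n + (E + E))   ∎
      where
        open ≤-Reasoning
        regroup : ∀ n e → (n + e) + (n + e) ≡ n + (n + (e + e))
        regroup = ℕ-Ring.solve-∀

sumFin-mono : ∀ {p} {f g : Fin p → ℕ} → (∀ j → f j ≤ g j) → sumFin f ≤ sumFin g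
sumFin-mono {zero}  f≤g = z≤n
sumFin-mono {suc p} f≤g = +-mono-≤ (f≤g zero) (sumFin-mono (λ j → f≤g (suc j)))

sumFin-const : ∀ p K → sumFin {p} (λ _ → K) ≡ p * K
sumFin-const zero    K = refl
sumFin-const (suc p) K = cong (K +_) (sumFin-const p K)

sumFin-linear : ∀ {p} c (f g : Fin p → ℕ) → sumFin (λ j → c * f j + g j) ≡ c * sumFin f + sumFin g
sumFin-linear {zero}  c f g = sym (trans (+-identityʳ (c * 0)) (*-zeroʳ c))
sumFin-linear {suc p} c f g = begin
  (c * f zero + g zero) + sumFin (λ j → c * f (suc j) + g (suc j))   ≡⟨ cong ((c * f zero + g zero) +_) (sumFin-linear c f′ g′) ⟩
  (c * f zero + g zero) + (c * sumFin f′ + sumFin g′)                ≡⟨ interchange (c * f zero) (g zero) _ _ ⟩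
  (c * f zero + c * sumFin f′) + (g zero + sumFin g′)                ≡⟨ cong (_+ sumFin g) (sym (*-distribˡ-+ c (f zero) _)) ⟩
  c * sumFin f + sumFin g                                            ∎
  where
    open ≡-Reasoning
    f′ g′ : Fin p → ℕ
    f′ j = f (suc j)
    g′ j = g (suc j)

inner-bounds : ∀ {p c E A n} (d : Fin p → ℕ) → Approximates c E A n → (∀ j → d j < n) →
  p * n ≤ c * inner A d n + sumFin d × c * inner A d n + sumFin d ≤ p * (n + E)
inner-bounds {p} {c} {E} {A} {n} d approx d<n =
  subst₂ _≤_ (sumFin-const p n) total (sumFin-mono (λ j → proj₁ (term j))) ,
  subst₂ _≤_ total (sumFin-const p (n + E)) (sumFin-mono (λ j → proj₂ (term j)))
  where
    term = λ j → look-back {c} {E} {A} approx (d j) (d<n j)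
    total : sumFin (λ j → c * A (n ∸ d j) + d j) ≡ c * inner A d n + sumFin d
    total = sumFin-linear c (λ j → A (n ∸ d j)) d

-- Under the approximation on [1, n], the recurrence at n forces c n ≈ 2 p n
-- (with errors independent of n apart from E).
recurrence-slope : ∀ {p s t} (a b : Fin p → ℕ) {c E A n} → Approximates c E A n →
  (∀ j → a j < n) → (∀ j → b j < n) → s + inner A a n < n → t + inner A b n < n →
  A n ≡ A (n ∸ (s + inner A a n)) + A (n ∸ (t + inner A b n)) →
  c * n ≤ 2 * p * n + (c * (s + t + E) + 2 * p * E) × 2 * p * n ≤ c * n + (c * (E + E) + sumFin a + sumFin b)
recurrence-slope {p} {s} {t} a b {c} {E} {A} {n} approx a<n b<n X<n Y<n A-rec = upper , lower
  where
    Ia = inner A a n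
    Ib = inner A b n
    dist = recurrence-distances {c} {E} {A} approx (s + Ia) (t + Ib) X<n Y<n A-rec
    ba = inner-bounds {p} {c} {E} {A} a approx a<n
    bb = inner-bounds {p} {c} {E} {A} b approx b<n
    upper : c * n ≤ 2 * p * n + (c * (s + t + E) + 2 * p * E)
    upper = begin
      c * n                                         ≤⟨ *-monoʳ-≤ c (proj₁ dist) ⟩
      c * ((s + Ia) + (t + Ib) + E)                 ≡⟨ expand c s t E Ia Ib ⟩
      c * (s + t + E) + (c * Ia + c * Ib)           ≤⟨ +-monoʳ-≤ (c * (s + t + E)) (+-mono-≤ (≤-trans (m≤m+n (c * Ia) (sumFin a)) (proj₂ ba))
                                                                                          (≤-trans (m≤m+n (c * Ib) (sumFin b)) (proj₂ bb))) ⟩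
      c * (s + t + E) + (p * (n + E) + p * (n + E)) ≡⟨ collect c s t E p n ⟩
      2 * p * n + (c * (s + t + E) + 2 * p * E)     ∎
      where
        open ≤-Reasoning
        expand : ∀ c s t E x y → c * ((s + x) + (t + y) + E) ≡ c * (s + t + E) + (c * x + c * y)
        expand = ℕ-Ring.solve-∀
        collect : ∀ c s t E p n → c * (s + t + E) + (p * (n + E) + p * (n + E)) ≡ 2 * p * n + (c * (s + t + E) + 2 * p * E)
        collect = ℕ-Ring.solve-∀
    lower : 2 * p * n ≤ c * n + (c * (E + E) + sumFin a + sumFin b)
    lower = begin
      2 * p * n                                            ≡⟨ double p n ⟩
      p * n + p * n                                        ≤⟨ +-mono-≤ (proj₁ ba) (proj₁ bb) ⟩
      (c * Ia + sumFin a) + (c * Ib + sumFin b)            ≤⟨ +-mono-≤ (+-monoˡ-≤ (sumFin a) (*-monoʳ-≤ c (m≤n+m Ia s)))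
                                                                       (+-monoˡ-≤ (sumFin b) (*-monoʳ-≤ c (m≤n+m Ib t))) ⟩
      (c * (s + Ia) + sumFin a) + (c * (t + Ib) + sumFin b) ≡⟨ gather c (s + Ia) (t + Ib) (sumFin a) (sumFin b) ⟩
      c * ((s + Ia) + (t + Ib)) + sumFin a + sumFin b       ≤⟨ +-monoˡ-≤ (sumFin b) (+-monoˡ-≤ (sumFin a) (*-monoʳ-≤ c (proj₂ dist))) ⟩
      c * (n + (E + E)) + sumFin a + sumFin b               ≡⟨ spread c n (E + E) (sumFin a) (sumFin b) ⟩
      c * n + (c * (E + E) + sumFin a + sumFin b)           ∎
      where
        open ≤-Reasoning
        double : ∀ p n → 2 * p * n ≡ p * n + p * n
        double = ℕ-Ring.solve-∀
        gather : ∀ c x y u v → (c * x + u) + (c * y + v) ≡ c * (x + y) + u + v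
        gather = ℕ-Ring.solve-∀
        spread : ∀ c n e u v → c * (n + e) + u + v ≡ c * n + (c * e + u + v)
        spread = ℕ-Ring.solve-∀

slope-gap : ∀ {c d n K} → c < d → d * n ≤ c * n + K → n ≤ K
slope-gap {c} {d} {n} {K} c<d dn≤cn+K = +-cancelˡ-≤ (c * n) n K (begin
  c * n + n   ≡⟨ +-comm (c * n) n ⟩
  suc c * n   ≤⟨ *-monoˡ-≤ n c<d ⟩
  d * n       ≤⟨ dn≤cn+K ⟩
  c * n + K   ∎)
  where open ≤-Reasoning

equal-slopes : ∀ {c d n K₁ K₂} → c * n ≤ d * n + K₁ → d * n ≤ c * n + K₂ → K₁ < n → K₂ < n → c ≡ d
equal-slopes {c} {d} cn≤ dn≤ K₁<n K₂<n with <-cmp c d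
... | tri< c<d _ _ = ⊥-elim (<⇒≱ K₂<n (slope-gap c<d dn≤))
... | tri≈ _ c≡d _ = c≡d
... | tri> _ _ d<c = ⊥-elim (<⇒≱ K₁<n (slope-gap d<c cn≤))

module Multiplicities {A : ℕ → ℕ} {α β : ℤ} (conolly : Conolly α β A) where

  positive : PositiveSeq A
  positive = proj₁ conolly

  nondecreasing : Nondecreasing A
  nondecreasing = proj₁ (proj₂ conolly)

  occurrences : ∀ m → Σ ℕ λ k → OccursExactly A (suc m) k × (ℤ.+ k ≡ α ℤ.+ β ℤ.* ℤ.+ ruler (suc m))
  occurrences m = proj₂ (proj₂ conolly) (suc m) (s≤s z≤n)

  mult : ℕ → ℕ
  mult zero    = 0
  mult (suc m) = proj₁ (occurrences m)

  lastIndex : ℕ → ℕ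
  lastIndex m = proj₁ (proj₁ (proj₂ (occurrences m)))

  absent-after : ∀ m n → lastIndex m < n → A n ≢ suc m
  absent-after m = proj₁ (proj₂ (proj₁ (proj₂ (occurrences m))))

  count-eventually : ∀ m N → lastIndex m ≤ N → countUpTo A (suc m) N ≡ mult (suc m)
  count-eventually m N last≤N =
    trans (countUpTo-frozen A (suc m) (absent-after m) N last≤N) (proj₂ (proj₂ (proj₁ (proj₂ (occurrences m)))))

  mult-pos : ∀ m i → 1 ≤ i → A i ≡ suc m → 1 ≤ mult (suc m)
  mult-pos m i 1≤i Ai≡m with i ≤? lastIndex m
  ... | yes i≤last = subst (1 ≤_) (count-eventually m (lastIndex m) ≤-refl)
                           (countUpTo-pos A (suc m) (lastIndex m) i 1≤i i≤last Ai≡m)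
  ... | no  i≰last = ⊥-elim (absent-after m i (≰⇒> i≰last) Ai≡m)

  below-eventually : ∀ M → ∃[ N₀ ] (∀ N → N₀ ≤ N → below A M N ≡ sumTo M mult)
  below-eventually zero    = 0 , λ _ _ → refl
  below-eventually (suc M) with below-eventually M
  ... | N₀ , stable = N₀ ⊔ lastIndex M , λ N N₀⊔last≤N →
    cong₂ _+_ (stable N (≤-trans (m≤m⊔n _ _) N₀⊔last≤N)) (count-eventually M N (≤-trans (m≤n⊔m _ _) N₀⊔last≤N))

  k₁ : ℕ
  k₁ = mult 1

  α+β≡k₁ : α ℤ.+ β ≡ ℤ.+ k₁
  α+β≡k₁ = trans (cong (λ z → α ℤ.+ z) (sym (ℤP.*-identityʳ β))) (sym (proj₂ (proj₂ (occurrences 0))))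

  mult-affineℤ : ∀ m → ℤ.+ mult (suc m) ≡ ℤ.+ k₁ ℤ.+ β ℤ.* ℤ.+ ν₂ (suc m)
  mult-affineℤ m = begin
    ℤ.+ mult (suc m)                                 ≡⟨ proj₂ (proj₂ (occurrences m)) ⟩
    α ℤ.+ β ℤ.* (ℤ.+ 1 ℤ.+ ℤ.+ ν₂ (suc m))          ≡⟨ split-ruler α β (ℤ.+ ν₂ (suc m)) ⟩
    (α ℤ.+ β) ℤ.+ β ℤ.* ℤ.+ ν₂ (suc m)              ≡⟨ cong (λ z → z ℤ.+ β ℤ.* ℤ.+ ν₂ (suc m)) α+β≡k₁ ⟩
    ℤ.+ k₁ ℤ.+ β ℤ.* ℤ.+ ν₂ (suc m)                  ∎
    where
      open ≡-Reasoning
      split-ruler : ∀ a b x → a ℤ.+ b ℤ.* (ℤ.+ 1 ℤ.+ x) ≡ (a ℤ.+ b) ℤ.+ b ℤ.* x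
      split-ruler = ℤ-Ring.solve-∀

  -- β ≥ 0: the value 2 ^ (k₁ + 1) would otherwise occur k₁ + β (k₁ + 1) < 0 times.
  β-nonneg : ∃[ b ] β ≡ ℤ.+ b
  β-nonneg with 2 ^ suc k₁ | ν₂-pow (suc k₁) | m^n>0 2 (suc k₁)
  ... | suc m | ν₂≡k₁+1 | _ = nonneg-slope β mult-at-power (n<1+n k₁)
    where
      mult-at-power : ℤ.+ mult (suc m) ≡ ℤ.+ k₁ ℤ.+ β ℤ.* ℤ.+ suc k₁
      mult-at-power = subst (λ v → ℤ.+ mult (suc m) ≡ ℤ.+ k₁ ℤ.+ β ℤ.* ℤ.+ v) ν₂≡k₁+1 (mult-affineℤ m)

  βℕ : ℕ
  βℕ = proj₁ β-nonneg

  mult-affine : ∀ m → mult (suc m) ≡ k₁ + βℕ * ν₂ (suc m)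
  mult-affine m = ℤP.+-injective (begin
    ℤ.+ mult (suc m)                        ≡⟨ mult-affineℤ m ⟩
    ℤ.+ k₁ ℤ.+ β ℤ.* ℤ.+ ν₂ (suc m)         ≡⟨ cong (λ γ → ℤ.+ k₁ ℤ.+ γ ℤ.* ℤ.+ ν₂ (suc m)) (proj₂ β-nonneg) ⟩
    ℤ.+ k₁ ℤ.+ ℤ.+ βℕ ℤ.* ℤ.+ ν₂ (suc m)    ≡⟨ cong (λ z → ℤ.+ k₁ ℤ.+ z) (sym (ℤP.pos-* βℕ (ν₂ (suc m)))) ⟩
    ℤ.+ k₁ ℤ.+ ℤ.+ (βℕ * ν₂ (suc m))        ≡⟨ sym (ℤP.pos-+ k₁ (βℕ * ν₂ (suc m))) ⟩
    ℤ.+ (k₁ + βℕ * ν₂ (suc m))              ∎)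
    where open ≡-Reasoning

  -- α + β > 0: a slow sequence takes an odd value, and odd values occur k₁ times.
  k₁-pos : Slow A → 1 ≤ k₁
  k₁-pos slow with slow-odd-value slow
  ... | i , q , 1≤i , Ai≡odd = subst (1 ≤_) odd-mult (mult-pos (2 * q) i 1≤i Ai≡odd)
    where
      odd-mult : mult (suc (2 * q)) ≡ k₁
      odd-mult = begin
        mult (suc (2 * q))             ≡⟨ mult-affine (2 * q) ⟩
        k₁ + βℕ * ν₂ (suc (2 * q))     ≡⟨ cong (λ v → k₁ + βℕ * v) (ν₂-odd q) ⟩
        k₁ + βℕ * 0                    ≡⟨ cong (k₁ +_) (*-zeroʳ βℕ) ⟩
        k₁ + 0                         ≡⟨ +-identityʳ k₁ ⟩
        k₁                             ∎
        where open ≡-Reasoning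

  k₂ : ℕ
  k₂ = k₁ + βℕ

  α+2β≡k₂ : α ℤ.+ ℤ.+ 2 ℤ.* β ≡ ℤ.+ k₂
  α+2β≡k₂ = begin
    α ℤ.+ ℤ.+ 2 ℤ.* β         ≡⟨ regroup α β ⟩
    (α ℤ.+ β) ℤ.+ β           ≡⟨ cong₂ ℤ._+_ α+β≡k₁ (proj₂ β-nonneg) ⟩
    ℤ.+ k₁ ℤ.+ ℤ.+ βℕ         ≡⟨ sym (ℤP.pos-+ k₁ βℕ) ⟩
    ℤ.+ k₂                    ∎
    where
      open ≡-Reasoning
      regroup : ∀ a b → a ℤ.+ ℤ.+ 2 ℤ.* b ≡ (a ℤ.+ b) ℤ.+ b
      regroup = ℤ-Ring.solve-∀

  cumulative : ∀ M → sumTo M mult ≡ M * k₁ + βℕ * V M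
  cumulative M = trans (sumTo-cong M mult-affine) (sumTo-affine M k₁ βℕ ν₂)

  k₂-times : ∀ M → k₂ * M ≡ M * k₁ + βℕ * M
  k₂-times M = distrib k₁ βℕ M
    where
      distrib : ∀ a b m → (a + b) * m ≡ m * a + b * m
      distrib = ℕ-Ring.solve-∀

  cumulative≤ : ∀ M → sumTo M mult ≤ k₂ * M
  cumulative≤ M = begin
    sumTo M mult      ≡⟨ cumulative M ⟩
    M * k₁ + βℕ * V M ≤⟨ +-monoʳ-≤ (M * k₁) (*-monoʳ-≤ βℕ (proj₁ (V-bounds M M (n<2^n M)))) ⟩
    M * k₁ + βℕ * M   ≡⟨ sym (k₂-times M) ⟩
    k₂ * M            ∎
    where open ≤-Reasoning

  cumulative≥ : ∀ k M → M < 2 ^ k → k₂ * M ≤ sumTo M mult + βℕ * k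
  cumulative≥ k M M<2^k = begin
    k₂ * M                          ≡⟨ k₂-times M ⟩
    M * k₁ + βℕ * M                 ≤⟨ +-monoʳ-≤ (M * k₁) (*-monoʳ-≤ βℕ (proj₂ (V-bounds k M M<2^k))) ⟩
    M * k₁ + βℕ * (V M + k)         ≡⟨ regroup (M * k₁) βℕ (V M) k ⟩
    (M * k₁ + βℕ * V M) + βℕ * k    ≡⟨ cong (_+ βℕ * k) (sym (cumulative M)) ⟩
    sumTo M mult + βℕ * k           ∎
    where
      open ≤-Reasoning
      regroup : ∀ x b v k → x + b * (v + k) ≡ (x + b * v) + b * k
      regroup = ℕ-Ring.solve-∀

  -- The key estimate: k₂ A(n) = n up to an error E = k₂ + βℕ k, whenever A n < 2 ^ k.
  -- At least n indices have value ≤ A n, at most n - 1 have value ≤ A n - 1.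
  linear-estimate : ∀ k n → 1 ≤ n → A n < 2 ^ k → n ≤ k₂ * A n × k₂ * A n ≤ n + (k₂ + βℕ * k)
  linear-estimate k (suc n) 1≤n An<2^k with A (suc n) in An≡ | positive (suc n) 1≤n
  ... | suc M | _ = lower , upper
    where
      A-below : ∀ i → 1 ≤ i → i ≤ suc n → A i ≤ suc M
      A-below i 1≤i i≤n = subst (A i ≤_) An≡ (nondecreasing-mono nondecreasing (suc n) 1≤i i≤n)
      A-above : ∀ i → suc n ≤ i → M < A i
      A-above i n<i = subst (_≤ A i) An≡ (nondecreasing-mono nondecreasing i (s≤s z≤n) n<i)
      N₀ = proj₁ (below-eventually (suc M))
      N₀′ = proj₁ (below-eventually M)
      lower : suc n ≤ k₂ * suc M
      lower = begin
        suc n                       ≤⟨ below-full A (suc M) (suc n) (λ i 1≤i i≤n → positive i 1≤i , A-below i 1≤i i≤n) ⟩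
        below A (suc M) (suc n)     ≤⟨ below-mono A (suc M) (N₀ ⊔ suc n) (m≤n⊔m N₀ (suc n)) ⟩
        below A (suc M) (N₀ ⊔ suc n) ≡⟨ proj₂ (below-eventually (suc M)) (N₀ ⊔ suc n) (m≤m⊔n N₀ (suc n)) ⟩
        sumTo (suc M) mult          ≤⟨ cumulative≤ (suc M) ⟩
        k₂ * suc M                  ∎
        where open ≤-Reasoning
      few-below : sumTo M mult ≤ n
      few-below = subst (_≤ n) (proj₂ (below-eventually M) N₀′ ≤-refl) (below-bounded A M n A-above N₀′)
      upper : k₂ * suc M ≤ suc n + (k₂ + βℕ * k)
      upper = begin
        k₂ * suc M                    ≡⟨ *-suc k₂ M ⟩
        k₂ + k₂ * M                   ≤⟨ +-monoʳ-≤ k₂ (cumulative≥ k M (<-trans (n<1+n M) An<2^k)) ⟩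
        k₂ + (sumTo M mult + βℕ * k)  ≤⟨ +-monoʳ-≤ k₂ (+-monoˡ-≤ (βℕ * k) few-below) ⟩
        k₂ + (n + βℕ * k)             ≡⟨ x∙yz≈y∙xz k₂ n (βℕ * k) ⟩
        n + (k₂ + βℕ * k)             ≤⟨ n≤1+n _ ⟩
        suc n + (k₂ + βℕ * k)         ∎
        where open ≤-Reasoning

  -- On a slow solution of the recurrence the slope k₂ = α + 2β equals 2p: with the
  -- error E = k₂ + βℕ k, the recurrence at n gives k₂ n ≈ 2 p n up to errors K₁, K₂
  -- affine in k; choose k with A 1 + n < 2 ^ k for n = K₁ + K₂ + c₀ + 1.
  slope-from-recurrence : ∀ {p s t} (a b : Fin p → ℕ) → WellDefinedSolution s t a b A → Slow A → k₂ ≡ 2 * p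
  slope-from-recurrence {p} {s} {t} a b (c₀ , _ , recurrence) slow =
    let a<n , b<n , _ , X<n , _ , Y<n , A-rec = recurrence n (s≤s (m≤n+m c₀ _))
        upper , lower = recurrence-slope a b {k₂} {E k} {A} approx a<n b<n X<n Y<n A-rec
    in equal-slopes upper lower (s≤s (≤-trans (m≤m+n (K₁ k) (K₂ k)) (m≤m+n _ c₀)))
                                (s≤s (≤-trans (m≤n+m (K₂ k) (K₁ k)) (m≤m+n _ c₀)))
    where
      E K₁ K₂ : ℕ → ℕ
      E k  = k₂ + βℕ * k
      K₁ k = k₂ * (s + t + E k) + 2 * p * E k
      K₂ k = k₂ * (E k + E k) + sumFin a + sumFin b
      U = A 1 + suc c₀ + k₂ * (s + t + k₂) + 2 * p * k₂ + k₂ * (k₂ + k₂) + sumFin a + sumFin b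
      W = (3 * k₂ + 2 * p) * βℕ
      k = proj₁ (affine<2^ U W)
      n = suc (K₁ k + K₂ k + c₀)
      A1+n<2^k : A 1 + n < 2 ^ k
      A1+n<2^k = subst (_< 2 ^ k) (sym (expand (A 1) c₀ k₂ βℕ k s t p (sumFin a) (sumFin b))) (proj₂ (affine<2^ U W))
        where
          expand : ∀ A₁ c₀ k₂ βℕ k s t p Sa Sb →
            A₁ + suc ((k₂ * (s + t + (k₂ + βℕ * k)) + 2 * p * (k₂ + βℕ * k))
                      + (k₂ * ((k₂ + βℕ * k) + (k₂ + βℕ * k)) + Sa + Sb) + c₀)
            ≡ (A₁ + suc c₀ + k₂ * (s + t + k₂) + 2 * p * k₂ + k₂ * (k₂ + k₂) + Sa + Sb)
              + (3 * k₂ + 2 * p) * βℕ * k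
          expand = ℕ-Ring.solve-∀
      approx : Approximates k₂ (E k) A n
      approx (suc m) 1≤m m<n = linear-estimate k (suc m) 1≤m
        (≤-<-trans (slow-growth slow m) (<-trans (+-monoʳ-< (A 1) m<n) A1+n<2^k))

corollary2p2 : (p : ℕ) → 1 ≤ p → (s t : ℕ) → (a b : Fin p → ℕ) →
    ((j : Fin p) → 1 ≤ a j) → ((j : Fin p) → 1 ≤ b j) →
    (A : ℕ → ℕ) → WellDefinedSolution s t a b A →
    (α β : ℤ) → Slow A → Conolly α β A →
    (α ℤ.+ ℤ.+ 2 ℤ.* β ≡ ℤ.+ 2 ℤ.* ℤ.+ p) × (ℤ.+ 0 ℤ.< α ℤ.+ β) × (ℤ.+ 0 ℤ.≤ β)
corollary2p2 p _ s t a b _ _ A solution α β slow conolly = α+2β≡2p , α+β>0 , β≥0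
  where
    open Multiplicities {A} {α} {β} conolly
    α+2β≡2p : α ℤ.+ ℤ.+ 2 ℤ.* β ≡ ℤ.+ 2 ℤ.* ℤ.+ p
    α+2β≡2p = trans α+2β≡k₂ (trans (cong ℤ.+_ (slope-from-recurrence a b solution slow)) (ℤP.pos-* 2 p))
    α+β>0 : ℤ.+ 0 ℤ.< α ℤ.+ β
    α+β>0 = subst (ℤ.+ 0 ℤ.<_) (sym α+β≡k₁) (ℤ.+<+ (k₁-pos slow))
    β≥0 : ℤ.+ 0 ℤ.≤ β
    β≥0 = subst (ℤ.+ 0 ℤ.≤_) (sym (proj₂ β-nonneg)) (ℤ.+≤+ z≤n)
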